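{- For every $n\ge2$, the $n$-crown poset $X_n$ is $2$-chain-retractable to the 2-chain, i.e. $X_n\oslash C_2\cong C_2$ and $X_n\oslash C_2\ne X_n$, where $C_2$ is the 2-element chain.
   Context: The $n$-crown poset $X_n$ ($n\ge2$) has $2n$ elements $a_1,\dots,a_n,b_1,\dots,b_n$ with $a_i<b_j$ iff $i\neq j$ and no other strict relations. For a poset $X$, $\ell(X)$ is the maximal cardinality of a chain. A subset $A$ of $X$ is maximally ordered in $X$ if $|\{(a,b)\in A\times A:a<b\}|$ is maximal among subsets of $X$ of cardinality $|A|$. For $\sigma\in\mathrm{Aut}(P)$, $\Sigma(\sigma)=\{p:\sigma(p)\ne p\}$. For a finite poset $Q$ and $r\ge2$, $\sigma$ is a $(Q,r)$-generator if there are subsets $S_0,\dots,S_{r-1}\subset\Sigma(\sigma)$, each isomorphic to $Q$, which are the smallest maximally ordered subsets of $\Sigma(\sigma)$ with $\sigma(S_i)=S_{i+1\bmod r}$, $\ell(S_i)=\ell(\Sigma(\sigma))$, $\bigcup_iS_i=\Sigma(\sigma)$. Elements $a,b$ are $(Q,r,1)$-symmetric if for such a $\sigma$, $a\in S_i$ and $b=\sigma^q(a)$, $1\le q<r$; $(Q,r)$-symmetry is the equivalence relation generated by this. $P\oslash_rQ$ is the quotient poset by this relation, with $A\le B$ iff $a\le b$ for some $a\in A,b\in B$; for $r=2$ write $P\oslash Q$. $P$ is $(Q,r)$-retractable to $R$ if $P\oslash_rQ\cong R$ and the equivalence relation is nontrivial ($P\oslash_rQ\ne P$). -}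

module Defs where

open import Level using (0ℓ)
open import Data.Nat as ℕ using (ℕ; zero; suc; NonZero) renaming (_≤_ to _≤ℕ_; _<_ to _<ℕ_)
open import Data.Nat.DivMod using (_mod_)
open import Data.Fin as Fin using (Fin; toℕ; splitAt; join)
open import Data.Fin.Properties using (_≟_; join-splitAt)
import Data.Fin.Properties as FinP
open import Data.Fin.Subset using (Subset; _∈_; _⊆_; ∣_∣)
open import Data.Fin.Subset.Properties using (_∈?_)
open import Data.Vec using (tabulate)
open import Data.List using (map; allFin)
open import Data.Nat.ListAction using (sum)
open import Data.Bool using (Bool; true; false; _∧_; not; if_then_else_)
open import Data.Product using (Σ; ∃; ∃₂; _×_; _,_)
open import Data.Sum using (_⊎_; inj₁; inj₂)
open import Data.Empty using (⊥-elim)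
open import Function.Bundles using (_⇔_)
open import Function.Definitions using (Injective)
open import Relation.Nullary using (¬_; Dec; yes; no; does)
open import Relation.Nullary.Decidable using (_×-dec_; ¬?)
open import Relation.Binary using (Rel; Decidable; IsPartialOrder; IsPreorder)
open import Relation.Binary.PropositionalEquality
  using (_≡_; _≢_; refl; sym; trans; cong; isEquivalence)
open import Relation.Binary.Construct.Closure.Equivalence using (EqClosure)

record FinPoset : Set₁ where
  field
    size           : ℕ
    _≤_            : Rel (Fin size) 0ℓ
    _≤?_           : Decidable _≤_
    isPartialOrder : IsPartialOrder _≡_ _≤_

iter : {A : Set} → ℕ → (A → A) → A → A
iter zero    f x = x
iter (suc k) f x = f (iter k f x)

next : (r : ℕ) .{{_ : NonZero r}} → Fin r → Fin r
next r i = suc (toℕ i) mod r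

module _ (P : FinPoset) where
  open FinPoset P

  _<_ : Rel (Fin size) 0ℓ
  x < y = x ≤ y × x ≢ y

  _<?_ : Decidable _<_
  x <? y = (x ≤? y) ×-dec ¬? (x ≟ y)

  ordPairs : Subset size → ℕ
  ordPairs A = sum (map (λ x → sum (map (λ y →
      if does (x ∈? A) ∧ does (y ∈? A) ∧ does (x <? y) then 1 else 0)
      (allFin size))) (allFin size))

  MaxOrderedIn : Subset size → Subset size → Set
  MaxOrderedIn X A = A ⊆ X × (∀ B → B ⊆ X → ∣ B ∣ ≡ ∣ A ∣ → ordPairs B ≤ℕ ordPairs A)

  IsChain : Subset size → Set
  IsChain C = ∀ {x y} → x ∈ C → y ∈ C → x ≤ y ⊎ y ≤ x

  HasLength : Subset size → ℕ → Set
  HasLength X k = (∃ λ C → C ⊆ X × IsChain C × ∣ C ∣ ≡ k)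
                × (∀ C → C ⊆ X → IsChain C → ∣ C ∣ ≤ℕ k)

  SameLength : Subset size → Subset size → Set
  SameLength X Y = ∃ λ k → HasLength X k × HasLength Y k

  record Automorphism : Set where
    field
      fun   : Fin size → Fin size
      inv   : Fin size → Fin size
      inv-l : ∀ x → inv (fun x) ≡ x
      inv-r : ∀ x → fun (inv x) ≡ x
      order : ∀ x y → (x ≤ y) ⇔ (fun x ≤ fun y)
  open Automorphism public

  support : Automorphism → Subset size
  support σ = tabulate (λ p → not (does (fun σ p ≟ p)))

  ImageIs : (Fin size → Fin size) → Subset size → Subset size → Set
  ImageIs f A B = (∀ q → q ∈ A → f q ∈ B) × (∀ p → p ∈ B → ∃ λ q → q ∈ A × f q ≡ p)

  IsoToSub : FinPoset → Subset size → Set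
  IsoToSub Q S = Σ (Fin (FinPoset.size Q) → Fin size) λ f →
      Injective _≡_ _≡_ f × (∀ x → f x ∈ S) × (∀ p → p ∈ S → ∃ λ x → f x ≡ p)
    × (∀ x y → FinPoset._≤_ Q x y ⇔ (f x ≤ f y))

  GenFamily : (r : ℕ) .{{_ : NonZero r}} → Automorphism → (Fin r → Subset size) → Set
  GenFamily r σ S =
      (∀ i → MaxOrderedIn (support σ) (S i)
           × ImageIs (fun σ) (S i) (S (next r i))
           × SameLength (S i) (support σ))
    × (∀ p → p ∈ support σ → ∃ λ i → p ∈ S i)

  IsGenerator : FinPoset → (r : ℕ) .{{_ : NonZero r}} → Automorphism → (Fin r → Subset size) → Set
  IsGenerator Q r σ S = GenFamily r σ S × (∀ i → IsoToSub Q (S i))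
    × (∀ T → GenFamily r σ T → ∀ i → ∣ S i ∣ ≤ℕ ∣ T i ∣)

  Sym1 : FinPoset → (r : ℕ) .{{_ : NonZero r}} → Rel (Fin size) 0ℓ
  Sym1 Q r a b = ∃₂ λ σ S → IsGenerator Q r σ S
    × (∃ λ i → a ∈ S i) × (∃ λ q → 1 ≤ℕ q × q <ℕ r × b ≡ iter q (fun σ) a)

  Sym : FinPoset → (r : ℕ) .{{_ : NonZero r}} → Rel (Fin size) 0ℓ
  Sym Q r = EqClosure (Sym1 Q r)

  -- order on the quotient, on representatives: [x] ≤ [y] iff a ≤ b for some a ∈ [x], b ∈ [y]
  QuotLe : FinPoset → (r : ℕ) .{{_ : NonZero r}} → Rel (Fin size) 0ℓ
  QuotLe Q r x y = ∃₂ λ a b → Sym Q r x a × Sym Q r y b × a ≤ b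

  -- P ⊘_r Q ≅ R : a map f : P → R inducing a bijection P/Sym → R that is an order isomorphism
  QuotientIso : FinPoset → (r : ℕ) .{{_ : NonZero r}} → FinPoset → Set
  QuotientIso Q r R = Σ (Fin size → Fin (FinPoset.size R)) λ f →
      (∀ x y → Sym Q r x y ⇔ (f x ≡ f y))
    × (∀ z → ∃ λ x → f x ≡ z)
    × (∀ x y → QuotLe Q r x y ⇔ FinPoset._≤_ R (f x) (f y))

  Retractable : FinPoset → (r : ℕ) .{{_ : NonZero r}} → FinPoset → Set
  Retractable Q r R = QuotientIso Q r R × (∃₂ λ x y → x ≢ y × Sym Q r x y)

C₂ : FinPoset
C₂ = record { size = 2 ; _≤_ = Fin._≤_ ; _≤?_ = Fin._≤?_
            ; isPartialOrder = FinP.≤-isPartialOrder }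

-- The n-crown: elements a_i = inj₁ i, b_j = inj₂ j (encoded in Fin (n + n)
-- via splitAt), with a_i < b_j iff i ≠ j and no other strict relations.

data CLe {n : ℕ} : Fin n ⊎ Fin n → Fin n ⊎ Fin n → Set where
  crefl : ∀ u → CLe u u
  cab   : ∀ {i j} → i ≢ j → CLe (inj₁ i) (inj₂ j)

CLe-trans : ∀ {n} {u v w : Fin n ⊎ Fin n} → CLe u v → CLe v w → CLe u w
CLe-trans (crefl _) q = q
CLe-trans (cab p) (crefl _) = cab p

CLe-antisym : ∀ {n} {u v : Fin n ⊎ Fin n} → CLe u v → CLe v u → u ≡ v
CLe-antisym (crefl _) _ = refl
CLe-antisym (cab p) ()

CLe? : ∀ {n} (u v : Fin n ⊎ Fin n) → Dec (CLe u v)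
CLe? (inj₁ i) (inj₁ j) with i ≟ j
... | yes refl = yes (crefl _)
... | no ¬p = no λ { (crefl _) → ¬p refl }
CLe? (inj₁ i) (inj₂ j) with i ≟ j
... | yes refl = no λ { (cab p) → p refl }
... | no ¬p = yes (cab ¬p)
CLe? (inj₂ i) (inj₁ j) = no λ ()
CLe? (inj₂ i) (inj₂ j) with i ≟ j
... | yes refl = yes (crefl _)
... | no ¬p = no λ { (crefl _) → ¬p refl }

Crown : ℕ → FinPoset
Crown n = record
  { size = n ℕ.+ n
  ; _≤_ = λ x y → CLe (splitAt n x) (splitAt n y)
  ; _≤?_ = λ x y → CLe? (splitAt n x) (splitAt n y)
  ; isPartialOrder = record
      { isPreorder = record
          { isEquivalence = isEquivalence
          ; reflexive = λ { refl → crefl _ }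
          ; trans = CLe-trans }
      ; antisym = λ {x} {y} p q → trans (sym (join-splitAt n n x))
          (trans (cong (join n n) (CLe-antisym p q)) (join-splitAt n n y)) }
  }

{-# OPTIONS --safe #-}
-- Every strict relation of the crown goes from some a_i up to some b_j, and for
-- n ≥ 2 the b_j are exactly its maximal elements, so automorphisms preserve the
-- two levels {a_i} and {b_j}: (C₂,2)-symmetric elements lie on the same level.
-- Conversely, for i ≠ j the automorphism exchanging the indices i and j is a
-- (C₂,2)-generator with S₀ = {a_i, b_j} and S₁ = {a_j, b_i}: these two 2-chains
-- cover its support and are swapped by it, every chain of the crown has at most
-- two elements, and every two-element subset carries at most one strict pair
-- (a subset with α lower and β upper elements carries at most αβ). Hence the
-- symmetry classes are exactly the two levels, and the quotient is the 2-chain.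

module Submission where

open import Defs
open import Data.Bool using (Bool; true; false; not; _∧_; if_then_else_)
open import Data.Empty using (⊥-elim)
open import Data.Fin as Fin using (Fin; zero; suc; splitAt; join; _↑ˡ_; _↑ʳ_)
open import Data.Fin.Patterns using (0F; 1F)
open import Data.Fin.Permutation using (Permutation′; _⟨$⟩ʳ_; _⟨$⟩ˡ_; inverseˡ; inverseʳ; transpose)
open import Data.Fin.Properties
  using (_≟_; suc-injective; 0≢1+n; ↑ˡ-injective; ↑ʳ-injective; splitAt-↑ˡ; splitAt-↑ʳ; splitAt-join; join-splitAt)
open import Data.Fin.Subset using (Subset; inside; outside; _∈_; _∉_; _⊆_; ∣_∣; ⁅_⁆; _∪_; _∩_; ∁)
open import Data.Fin.Subset.Properties
  using (_∈?_; ⊆-refl; Empty-unique; p⊆q⇒∣p∣≤∣q∣; ∣⊥∣≡0; x∈p⇒∣p-x∣<∣p∣; x∈⁅x⁆; x∈⁅y⁆⇒x≡y;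
         x∈p∪q⁺; x∈p∪q⁻; x∈p∩q⁺; x∈p∩q⁻; x∈∁p⇒x∉p; x∉p⇒x∈∁p)
import Data.List as List
open import Data.List.Properties using (map-tabulate)
open import Data.Nat using (ℕ; zero; suc; _+_; _*_; _≤_; z≤n; s≤s; NonZero)
import Data.Nat.ListAction as ListAction
open import Data.Nat.Properties
  using (module ≤-Reasoning; ≤-refl; ≤-reflexive; ≤-trans; ≤-antisym; +-mono-≤; m≤m+n; m+n≤o⇒n≤o;
         +-suc; +-identityʳ; *-zeroʳ; +-*-semiring)
open import Algebra.Properties.Semiring.Sum +-*-semiring
  using (sum; sum-syntax; sum-cong-≗; sum-remove; *-distribˡ-sum; *-distribʳ-sum)
open import Data.Product using (∃; _×_; _,_; proj₁; proj₂)
open import Data.Sum as Sum using (_⊎_; inj₁; inj₂)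
open import Data.Sum.Properties using (map-map; map-cong; map-id)
open import Data.Vec using ([]; _∷_; here; there; tabulate)
open import Data.Vec.Properties using (lookup∘tabulate; []=⇒lookup; lookup⇒[]=)
open import Function using (id; _∘_; const)
open import Function.Bundles using (_⇔_; mk⇔; Equivalence)
open import Relation.Binary using (IsPartialOrder)
import Relation.Binary.Construct.Closure.Equivalence as EqClosure
open import Relation.Binary.PropositionalEquality
  using (_≡_; _≢_; refl; sym; trans; cong; cong₂; subst; subst₂; isEquivalence; module ≡-Reasoning)
open import Relation.Nullary using (Dec; yes; no; does)
open import Relation.Nullary.Decidable using (dec-true; dec-false; does-⇔)
open import Relation.Nullary.Negation using (contradiction)

sum-tabulate : ∀ {n} (f : Fin n → ℕ) → ListAction.sum (List.tabulate f) ≡ ∑[ i < n ] f i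
sum-tabulate {zero}  f = refl
sum-tabulate {suc n} f = cong (f zero +_) (sum-tabulate (f ∘ suc))

sum-map-allFin : ∀ {n} (f : Fin n → ℕ) → ListAction.sum (List.map f (List.allFin n)) ≡ ∑[ i < n ] f i
sum-map-allFin f = trans (cong ListAction.sum (map-tabulate id f)) (sum-tabulate f)

∑-mono-≤ : ∀ {n} {f g : Fin n → ℕ} → (∀ i → f i ≤ g i) → ∑[ i < n ] f i ≤ ∑[ i < n ] g i
∑-mono-≤ {zero}  _   = z≤n
∑-mono-≤ {suc n} f≤g = +-mono-≤ (f≤g zero) (∑-mono-≤ (f≤g ∘ suc))

≤-∑ : ∀ {n} (f : Fin n → ℕ) i → f i ≤ ∑[ j < n ] f j
≤-∑ {suc _} f i = ≤-trans (m≤m+n (f i) _) (≤-reflexive (sym (sum-remove {i = i} f)))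

∑∑-* : ∀ {m n} (f : Fin m → ℕ) (g : Fin n → ℕ) →
       ∑[ i < m ] ∑[ j < n ] (f i * g j) ≡ (∑[ i < m ] f i) * (∑[ j < n ] g j)
∑∑-* f g = begin
  ∑[ i < _ ] ∑[ j < _ ] (f i * g j)  ≡⟨ sum-cong-≗ (λ i → sym (*-distribˡ-sum (f i) g)) ⟩
  ∑[ i < _ ] (f i * sum g)           ≡⟨ sym (*-distribʳ-sum (sum g) f) ⟩
  sum f * sum g                      ∎
  where open ≡-Reasoning

m+n≤2⇒m*n≤1 : ∀ m n → m + n ≤ 2 → m * n ≤ 1
m+n≤2⇒m*n≤1 0             n       _              = z≤n
m+n≤2⇒m*n≤1 1             n       (s≤s n≤1)      = subst (_≤ 1) (sym (+-identityʳ n)) n≤1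
m+n≤2⇒m*n≤1 (suc (suc m)) zero    _              = subst (_≤ 1) (sym (*-zeroʳ (suc (suc m)))) z≤n
m+n≤2⇒m*n≤1 (suc (suc m)) (suc n) (s≤s (s≤s le)) = contradiction (m+n≤o⇒n≤o m le) λ ()

𝟙[_∈_] : ∀ {n} → Fin n → Subset n → ℕ
𝟙[ x ∈ p ] = if does (x ∈? p) then 1 else 0

𝟙[∈]≡1 : ∀ {n} {x : Fin n} {p} → x ∈ p → 𝟙[ x ∈ p ] ≡ 1
𝟙[∈]≡1 {x = x} {p} x∈p = cong (if_then 1 else 0) (dec-true (x ∈? p) x∈p)

∣p∣≡∑𝟙 : ∀ {n} (p : Subset n) → ∣ p ∣ ≡ ∑[ x < n ] 𝟙[ x ∈ p ]
∣p∣≡∑𝟙 []            = refl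
∣p∣≡∑𝟙 (inside  ∷ p) = cong suc (∣p∣≡∑𝟙 p)
∣p∣≡∑𝟙 (outside ∷ p) = ∣p∣≡∑𝟙 p

∣p∣≡∣p∩∁q∣+∣p∩q∣ : ∀ {n} (p q : Subset n) → ∣ p ∣ ≡ ∣ p ∩ ∁ q ∣ + ∣ p ∩ q ∣
∣p∣≡∣p∩∁q∣+∣p∩q∣ []            []            = refl
∣p∣≡∣p∩∁q∣+∣p∩q∣ (inside  ∷ p) (outside ∷ q) = cong suc (∣p∣≡∣p∩∁q∣+∣p∩q∣ p q)
∣p∣≡∣p∩∁q∣+∣p∩q∣ (inside  ∷ p) (inside  ∷ q) =
  trans (cong suc (∣p∣≡∣p∩∁q∣+∣p∩q∣ p q)) (sym (+-suc ∣ p ∩ ∁ q ∣ ∣ p ∩ q ∣))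
∣p∣≡∣p∩∁q∣+∣p∩q∣ (outside ∷ p) (_       ∷ q) = ∣p∣≡∣p∩∁q∣+∣p∩q∣ p q

∣p∣≤1 : ∀ {n} {p : Subset n} → (∀ {x y} → x ∈ p → y ∈ p → x ≡ y) → ∣ p ∣ ≤ 1
∣p∣≤1 {p = []}          _      = z≤n
∣p∣≤1 {p = outside ∷ p} unique = ∣p∣≤1 λ x∈p y∈p → suc-injective (unique (there x∈p) (there y∈p))
∣p∣≤1 {n = suc n} {p = inside ∷ p} unique = s≤s (≤-reflexive ∣p∣≡0)
  where
  ∣p∣≡0 : ∣ p ∣ ≡ 0
  ∣p∣≡0 = trans (cong ∣_∣ (Empty-unique λ (x , x∈p) → 0≢1+n (unique here (there x∈p)))) (∣⊥∣≡0 n)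

x∈p⇒1≤∣p∣ : ∀ {n} {x : Fin n} {p} → x ∈ p → 1 ≤ ∣ p ∣
x∈p⇒1≤∣p∣ x∈p = ≤-trans (s≤s z≤n) (x∈p⇒∣p-x∣<∣p∣ x∈p)

∈-tabulate⁺ : ∀ {n} {f : Fin n → Bool} {x} → f x ≡ true → x ∈ tabulate f
∈-tabulate⁺ {f = f} {x} fx≡true = lookup⇒[]= x _ (trans (lookup∘tabulate f x) fx≡true)

∉-tabulate : ∀ {n} {f : Fin n → Bool} {x} → f x ≡ false → x ∉ tabulate f
∉-tabulate {f = f} {x} fx≡false x∈
  with () ← trans (sym fx≡false) (trans (sym (lookup∘tabulate f x)) ([]=⇒lookup x∈))

pair : ∀ {n} → Fin n → Fin n → Subset n
pair x y = ⁅ x ⁆ ∪ ⁅ y ⁆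

module _ {n} {x y : Fin n} where

  x∈pair : x ∈ pair x y
  x∈pair = x∈p∪q⁺ (inj₁ (x∈⁅x⁆ x))

  y∈pair : y ∈ pair x y
  y∈pair = x∈p∪q⁺ (inj₂ (x∈⁅x⁆ y))

  ∈pair⁻ : ∀ {z} → z ∈ pair x y → z ≡ x ⊎ z ≡ y
  ∈pair⁻ z∈ = Sum.map (x∈⁅y⁆⇒x≡y x) (x∈⁅y⁆⇒x≡y y) (x∈p∪q⁻ ⁅ x ⁆ ⁅ y ⁆ z∈)

  pair⊆ : ∀ {p} → x ∈ p → y ∈ p → pair x y ⊆ p
  pair⊆ x∈p y∈p z∈ with ∈pair⁻ z∈
  ... | inj₁ refl = x∈p
  ... | inj₂ refl = y∈p

module _ {n} (i j : Fin n) where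

  transpose-ˡ : transpose i j ⟨$⟩ʳ i ≡ j
  transpose-ˡ rewrite dec-true (i ≟ i) refl = refl

  transpose-ʳ : transpose i j ⟨$⟩ʳ j ≡ i
  transpose-ʳ with j ≟ i
  ... | yes j≡i = j≡i
  ... | no  _   rewrite dec-true (j ≟ j) refl = refl

  transpose-moved : ∀ {k} → transpose i j ⟨$⟩ʳ k ≢ k → k ≡ i ⊎ k ≡ j
  transpose-moved {k} moved with k ≟ i
  ... | yes k≡i = inj₁ k≡i
  ... | no  _ with k ≟ j
  ...   | yes k≡j = inj₂ k≡j
  ...   | no  _   = ⊥-elim (moved refl)

another : ∀ {n} → 2 ≤ n → (k : Fin n) → ∃ λ l → l ≢ k
another (s≤s (s≤s _)) 0F      = 1F , λ ()
another (s≤s (s≤s _)) (suc _) = 0F , λ ()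

iter-invariant : ∀ {A B : Set} (g : A → B) {f : A → A} →
                 (∀ x → g (f x) ≡ g x) → ∀ q x → g (iter q f x) ≡ g x
iter-invariant g g∘f≗g zero    x = refl
iter-invariant g g∘f≗g (suc q) x = trans (g∘f≗g (iter q _ x)) (iter-invariant g g∘f≗g q x)

module Poset (P : FinPoset) where

  open FinPoset P renaming (_≤_ to _⊑_)
  open IsPartialOrder isPartialOrder using (antisym) renaming (refl to ⊑-refl)

  _⊏_ : Fin size → Fin size → Set
  _⊏_ = _<_ P

  Maximal : Fin size → Set
  Maximal x = ∀ {y} → x ⊑ y → y ≡ x

  mkAutomorphism : (f g : Fin size → Fin size) →
                   (∀ x → g (f x) ≡ x) → (∀ x → f (g x) ≡ x) →
                   (∀ {x y} → x ⊑ y → f x ⊑ f y) → (∀ {x y} → x ⊑ y → g x ⊑ g y) →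
                   Automorphism P
  mkAutomorphism f g g∘f≗id f∘g≗id f-mono g-mono = record
    { fun   = f
    ; inv   = g
    ; inv-l = g∘f≗id
    ; inv-r = f∘g≗id
    ; order = λ x y → mk⇔ f-mono (λ fx⊑fy → subst₂ _⊑_ (g∘f≗id x) (g∘f≗id y) (g-mono fx⊑fy))
    }

  module _ (σ : Automorphism P) where

    fun-injective : ∀ {x y} → fun σ x ≡ fun σ y → x ≡ y
    fun-injective {x} {y} σx≡σy = trans (sym (inv-l σ x)) (trans (cong (inv σ) σx≡σy) (inv-l σ y))

    automorphism-preserves-Maximal : ∀ {x} → Maximal x → Maximal (fun σ x)
    automorphism-preserves-Maximal {x} x-max {y} σx⊑y =
      trans (sym (inv-r σ y)) (cong (fun σ) (x-max x⊑σ⁻¹y))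
      where
      x⊑σ⁻¹y : x ⊑ inv σ y
      x⊑σ⁻¹y = Equivalence.from (order σ x (inv σ y)) (subst (fun σ x ⊑_) (sym (inv-r σ y)) σx⊑y)

    automorphism-reflects-Maximal : ∀ {x} → Maximal (fun σ x) → Maximal x
    automorphism-reflects-Maximal {x} σx-max {y} x⊑y =
      fun-injective (σx-max (Equivalence.to (order σ x y) x⊑y))

    ∈support⁺ : ∀ {p} → fun σ p ≢ p → p ∈ support P σ
    ∈support⁺ {p} moved = ∈-tabulate⁺ (cong not (dec-false (fun σ p ≟ p) moved))

    ∈support⁻ : ∀ {p} → p ∈ support P σ → fun σ p ≢ p
    ∈support⁻ {p} p∈ fixed = ∉-tabulate (cong not (dec-true (fun σ p ≟ p) fixed)) p∈

  Sym-invariant : ∀ {B : Set} (g : Fin size → B) → (∀ σ x → g (fun σ x) ≡ g x) →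
                  ∀ {Q r} .{{_ : NonZero r}} {x y} → Sym P Q r x y → g x ≡ g y
  Sym-invariant g g-invariant = EqClosure.gfold isEquivalence g
    λ (σ , _ , _ , _ , q , _ , _ , y≡σ^qx) → sym (trans (cong g y≡σ^qx) (iter-invariant g (g-invariant σ) q _))

  ordered : Subset size → Fin size → Fin size → ℕ
  ordered B x y = if does (x ∈? B) ∧ does (y ∈? B) ∧ does (_<?_ P x y) then 1 else 0

  ordPairs≡∑∑ : ∀ B → ordPairs P B ≡ ∑[ x < size ] ∑[ y < size ] ordered B x y
  ordPairs≡∑∑ B = trans (sum-map-allFin (λ x → ListAction.sum (List.map (ordered B x) (List.allFin size))))
                        (sum-cong-≗ λ x → sum-map-allFin (ordered B x))

  1≤ordPairs : ∀ {B x y} → x ∈ B → y ∈ B → x ⊏ y → 1 ≤ ordPairs P B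
  1≤ordPairs {B} {x} {y} x∈B y∈B x⊏y = begin
    1                                           ≡⟨ sym ordered≡1 ⟩
    ordered B x y                               ≤⟨ ≤-∑ (ordered B x) y ⟩
    ∑[ y < size ] ordered B x y                 ≤⟨ ≤-∑ (λ x → ∑[ y < size ] ordered B x y) x ⟩
    ∑[ x < size ] ∑[ y < size ] ordered B x y   ≡⟨ sym (ordPairs≡∑∑ B) ⟩
    ordPairs P B                                ∎
    where
    open ≤-Reasoning
    ordered≡1 : ordered B x y ≡ 1
    ordered≡1 rewrite dec-true (x ∈? B) x∈B | dec-true (y ∈? B) y∈B | dec-true (_<?_ P x y) x⊏y = refl

  pair-isChain : ∀ {x y} → x ⊑ y → IsChain P (pair x y)
  pair-isChain x⊑y z∈ w∈ with ∈pair⁻ z∈ | ∈pair⁻ w∈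
  ... | inj₁ refl | inj₁ refl = inj₁ ⊑-refl
  ... | inj₁ refl | inj₂ refl = inj₁ x⊑y
  ... | inj₂ refl | inj₁ refl = inj₂ x⊑y
  ... | inj₂ refl | inj₂ refl = inj₁ ⊑-refl

  pair≅C₂ : ∀ {x y} → x ⊏ y → IsoToSub P C₂ (pair x y)
  pair≅C₂ {x} {y} (x⊑y , x≢y) = g , g-injective , g-∈ , g-onto , g-order
    where
    g : Fin 2 → Fin size
    g 0F = x
    g 1F = y
    g-injective : ∀ {i j} → g i ≡ g j → i ≡ j
    g-injective {0F} {0F} _   = refl
    g-injective {0F} {1F} x≡y = ⊥-elim (x≢y x≡y)
    g-injective {1F} {0F} y≡x = ⊥-elim (x≢y (sym y≡x))
    g-injective {1F} {1F} _   = refl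
    g-∈ : ∀ i → g i ∈ pair x y
    g-∈ 0F = x∈pair
    g-∈ 1F = y∈pair
    g-onto : ∀ z → z ∈ pair x y → ∃ λ i → g i ≡ z
    g-onto z z∈ with ∈pair⁻ z∈
    ... | inj₁ refl = 0F , refl
    ... | inj₂ refl = 1F , refl
    g-order : ∀ i j → FinPoset._≤_ C₂ i j ⇔ (g i ⊑ g j)
    g-order 0F 0F = mk⇔ (λ _ → ⊑-refl) (λ _ → z≤n)
    g-order 0F 1F = mk⇔ (λ _ → x⊑y) (λ _ → z≤n)
    g-order 1F 0F = mk⇔ (λ ()) (λ y⊑x → ⊥-elim (x≢y (antisym x⊑y y⊑x)))
    g-order 1F 1F = mk⇔ (λ _ → ⊑-refl) (λ _ → s≤s z≤n)

  pair-image : ∀ (f : Fin size → Fin size) {x y} → ImageIs P f (pair x y) (pair (f x) (f y))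
  pair-image f =
      (λ z z∈ → Sum.[ (λ { refl → x∈pair }) , (λ { refl → y∈pair }) ] (∈pair⁻ z∈))
    , (λ z z∈ → Sum.[ (λ { refl → _ , x∈pair , refl }) , (λ { refl → _ , y∈pair , refl }) ] (∈pair⁻ z∈))

  sameLength⇒∣chain∣≤∣Y∣ : ∀ {X Y C} → SameLength P Y X → C ⊆ X → IsChain P C → ∣ C ∣ ≤ ∣ Y ∣
  sameLength⇒∣chain∣≤∣Y∣ {Y = Y} (k , ((D , D⊆Y , _ , ∣D∣≡k) , _) , (_ , X-chains≤k)) C⊆X C-chain =
    ≤-trans (X-chains≤k _ C⊆X C-chain) (subst (_≤ ∣ Y ∣) ∣D∣≡k (p⊆q⇒∣p∣≤∣q∣ D⊆Y))

-- Posets of height two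

module TwoLevel (P : FinPoset) (T : Subset (FinPoset.size P))
                (⊏⇒∉∈ : ∀ {x y} → Poset._⊏_ P x y → x ∉ T × y ∈ T) where

  open FinPoset P renaming (_≤_ to _⊑_)
  open IsPartialOrder isPartialOrder using () renaming (refl to ⊑-refl)
  open Poset P

  ∈T⇒Maximal : ∀ {x} → x ∈ T → Maximal x
  ∈T⇒Maximal {x} x∈T {y} x⊑y with y ≟ x
  ... | yes y≡x = y≡x
  ... | no  y≢x = ⊥-elim (proj₁ (⊏⇒∉∈ (x⊑y , y≢x ∘ sym)) x∈T)

  ∉T⇒minimal : ∀ {x y} → y ∉ T → x ⊑ y → x ≡ y
  ∉T⇒minimal {x} {y} y∉T x⊑y with x ≟ y
  ... | yes x≡y = x≡y
  ... | no  x≢y = ⊥-elim (y∉T (proj₂ (⊏⇒∉∈ (x⊑y , x≢y))))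

  ∣C∩T∣≤1 : ∀ {C} → IsChain P C → ∣ C ∩ T ∣ ≤ 1
  ∣C∩T∣≤1 {C} C-chain = ∣p∣≤1 λ x∈ y∈ →
    let x∈C , x∈T = x∈p∩q⁻ C T x∈
        y∈C , y∈T = x∈p∩q⁻ C T y∈
    in Sum.[ sym ∘ ∈T⇒Maximal x∈T , ∈T⇒Maximal y∈T ] (C-chain x∈C y∈C)

  ∣C∩∁T∣≤1 : ∀ {C} → IsChain P C → ∣ C ∩ ∁ T ∣ ≤ 1
  ∣C∩∁T∣≤1 {C} C-chain = ∣p∣≤1 λ x∈ y∈ →
    let x∈C , x∈∁T = x∈p∩q⁻ C (∁ T) x∈
        y∈C , y∈∁T = x∈p∩q⁻ C (∁ T) y∈
    in Sum.[ ∉T⇒minimal (x∈∁p⇒x∉p y∈∁T) , sym ∘ ∉T⇒minimal (x∈∁p⇒x∉p x∈∁T) ] (C-chain x∈C y∈C)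

  ∣chain∣≤2 : ∀ {C} → IsChain P C → ∣ C ∣ ≤ 2
  ∣chain∣≤2 {C} C-chain = subst (_≤ 2) (sym (∣p∣≡∣p∩∁q∣+∣p∩q∣ C T))
    (+-mono-≤ (∣C∩∁T∣≤1 C-chain) (∣C∩T∣≤1 C-chain))

  ∣pair∣≡2 : ∀ {x y} → x ⊏ y → ∣ pair x y ∣ ≡ 2
  ∣pair∣≡2 {x} {y} x⊏y@(x⊑y , _) = ≤-antisym (∣chain∣≤2 (pair-isChain x⊑y))
    (subst (2 ≤_) (sym (∣p∣≡∣p∩∁q∣+∣p∩q∣ (pair x y) T))
      (+-mono-≤ (x∈p⇒1≤∣p∣ (x∈p∩q⁺ (x∈pair {y = y} , x∉p⇒x∈∁p (proj₁ (⊏⇒∉∈ x⊏y)))))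
                (x∈p⇒1≤∣p∣ (x∈p∩q⁺ (y∈pair {x = x} , proj₂ (⊏⇒∉∈ x⊏y))))))

  ordPairs≤∣B∩∁T∣*∣B∩T∣ : ∀ B → ordPairs P B ≤ ∣ B ∩ ∁ T ∣ * ∣ B ∩ T ∣
  ordPairs≤∣B∩∁T∣*∣B∩T∣ B = begin
    ordPairs P B
      ≡⟨ ordPairs≡∑∑ B ⟩
    ∑[ x < size ] ∑[ y < size ] ordered B x y
      ≤⟨ ∑-mono-≤ (λ x → ∑-mono-≤ (ordered≤ x)) ⟩
    ∑[ x < size ] ∑[ y < size ] (𝟙[ x ∈ B ∩ ∁ T ] * 𝟙[ y ∈ B ∩ T ])
      ≡⟨ ∑∑-* (λ x → 𝟙[ x ∈ B ∩ ∁ T ]) (λ y → 𝟙[ y ∈ B ∩ T ]) ⟩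
    (∑[ x < size ] 𝟙[ x ∈ B ∩ ∁ T ]) * (∑[ y < size ] 𝟙[ y ∈ B ∩ T ])
      ≡⟨ sym (cong₂ _*_ (∣p∣≡∑𝟙 (B ∩ ∁ T)) (∣p∣≡∑𝟙 (B ∩ T))) ⟩
    ∣ B ∩ ∁ T ∣ * ∣ B ∩ T ∣
      ∎
    where
    open ≤-Reasoning
    ordered≤ : ∀ x y → ordered B x y ≤ 𝟙[ x ∈ B ∩ ∁ T ] * 𝟙[ y ∈ B ∩ T ]
    ordered≤ x y with x ∈? B | y ∈? B
    ... | yes x∈B | yes y∈B = strict-pair (_<?_ P x y)
      where
      strict-pair : (x⊏y? : Dec (x ⊏ y)) → (if does x⊏y? then 1 else 0) ≤ 𝟙[ x ∈ B ∩ ∁ T ] * 𝟙[ y ∈ B ∩ T ]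
      strict-pair (no _)    = z≤n
      strict-pair (yes x⊏y) = ≤-reflexive (sym (cong₂ _*_
        (𝟙[∈]≡1 (x∈p∩q⁺ (x∈B , x∉p⇒x∈∁p (proj₁ (⊏⇒∉∈ x⊏y)))))
        (𝟙[∈]≡1 (x∈p∩q⁺ (y∈B , proj₂ (⊏⇒∉∈ x⊏y))))))
    ... | yes _ | no _ = z≤n
    ... | no _  | _    = z≤n

  ordPairs≤1 : ∀ B → ∣ B ∣ ≤ 2 → ordPairs P B ≤ 1
  ordPairs≤1 B ∣B∣≤2 = ≤-trans (ordPairs≤∣B∩∁T∣*∣B∩T∣ B)
    (m+n≤2⇒m*n≤1 ∣ B ∩ ∁ T ∣ ∣ B ∩ T ∣ (subst (_≤ 2) (∣p∣≡∣p∩∁q∣+∣p∩q∣ B T) ∣B∣≤2))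

  pair-hasLength : ∀ {x y X} → x ⊏ y → pair x y ⊆ X → HasLength P X 2
  pair-hasLength x⊏y@(x⊑y , _) pair⊆X =
    (pair _ _ , pair⊆X , pair-isChain x⊑y , ∣pair∣≡2 x⊏y) , λ _ _ → ∣chain∣≤2

  pair-maxOrdered : ∀ {x y X} → x ⊏ y → pair x y ⊆ X → MaxOrderedIn P X (pair x y)
  pair-maxOrdered x⊏y pair⊆X = pair⊆X , λ B _ ∣B∣≡∣pair∣ →
    ≤-trans (ordPairs≤1 B (≤-reflexive (trans ∣B∣≡∣pair∣ (∣pair∣≡2 x⊏y))))
            (1≤ordPairs x∈pair y∈pair x⊏y)

  cyclic-pairs-isGenerator :
    ∀ {r} .{{_ : NonZero r}} (σ : Automorphism P) (x y : Fin r → Fin size) →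
    (∀ i → x i ⊏ y i) →
    (∀ i → pair (x i) (y i) ⊆ support P σ) →
    (∀ i → fun σ (x i) ≡ x (next r i)) →
    (∀ i → fun σ (y i) ≡ y (next r i)) →
    (∀ p → p ∈ support P σ → ∃ λ i → p ∈ pair (x i) (y i)) →
    IsGenerator P C₂ r σ (λ i → pair (x i) (y i))
  cyclic-pairs-isGenerator {r} σ x y x⊏y pair⊆Σ σx σy covers =
      ((λ i → pair-maxOrdered (x⊏y i) (pair⊆Σ i)
            , image i
            , (2 , pair-hasLength (x⊏y i) ⊆-refl , pair-hasLength (x⊏y i) (pair⊆Σ i)))
      , covers)
    , (λ i → pair≅C₂ (x⊏y i))
    , λ S S-family i → sameLength⇒∣chain∣≤∣Y∣ (proj₂ (proj₂ (proj₁ S-family i)))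
                         (pair⊆Σ i) (pair-isChain (proj₁ (x⊏y i)))
    where
    image : ∀ i → ImageIs P (fun σ) (pair (x i) (y i)) (pair (x (next r i)) (y (next r i)))
    image i = subst₂ (λ u v → ImageIs P (fun σ) (pair (x i) (y i)) (pair u v)) (σx i) (σy i)
                     (pair-image (fun σ))

  level : Fin size → Fin 2
  level x = if does (x ∈? T) then 1F else 0F

  level-∈ : ∀ {x} → x ∈ T → level x ≡ 1F
  level-∈ {x} x∈T = cong (if_then 1F else 0F) (dec-true (x ∈? T) x∈T)

  level-∉ : ∀ {x} → x ∉ T → level x ≡ 0F
  level-∉ {x} x∉T = cong (if_then 1F else 0F) (dec-false (x ∈? T) x∉T)

  level-monotone : ∀ {x y} → x ⊑ y → level x Fin.≤ level y
  level-monotone {x} {y} x⊑y with x ≟ y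
  ... | yes refl = ≤-refl
  ... | no  x≢y  = subst (Fin._≤ level y) (sym (level-∉ (proj₁ (⊏⇒∉∈ (x⊑y , x≢y))))) z≤n

  module Covered (below-T : ∀ {x} → x ∉ T → ∃ λ z → z ∈ T × x ⊑ z) where

    Maximal⇒∈T : ∀ {x} → Maximal x → x ∈ T
    Maximal⇒∈T {x} x-max with x ∈? T
    ... | yes x∈T = x∈T
    ... | no  x∉T = let z , z∈T , x⊑z = below-T x∉T in ⊥-elim (x∉T (subst (_∈ T) (x-max x⊑z) z∈T))

    level-invariant : ∀ σ x → level (fun σ x) ≡ level x
    level-invariant σ x = cong (if_then 1F else 0F) (does-⇔ σx∈T⇔x∈T (fun σ x ∈? T) (x ∈? T))
      where
      σx∈T⇔x∈T : fun σ x ∈ T ⇔ x ∈ T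
      σx∈T⇔x∈T = mk⇔ (Maximal⇒∈T ∘ automorphism-reflects-Maximal σ ∘ ∈T⇒Maximal)
                      (Maximal⇒∈T ∘ automorphism-preserves-Maximal σ ∘ ∈T⇒Maximal)

    quotient≅C₂ : ∀ {Q r} .{{_ : NonZero r}} →
                  (∀ {x y} → level x ≡ level y → Sym P Q r x y) →
                  (∃ λ x → x ∉ T) → (∃ λ y → y ∈ T) →
                  QuotientIso P Q r C₂
    quotient≅C₂ {Q} {r} sameLevel⇒Sym (x₀ , x₀∉T) (y₀ , y₀∈T) =
        level , (λ x y → mk⇔ Sym⇒sameLevel sameLevel⇒Sym)
      , level-onto , λ x y → mk⇔ QuotLe⇒≤ (≤⇒QuotLe x y)
      where
      Sym⇒sameLevel : ∀ {x y} → Sym P Q r x y → level x ≡ level y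
      Sym⇒sameLevel = Sym-invariant level level-invariant {Q} {r}

      level-onto : ∀ i → ∃ λ x → level x ≡ i
      level-onto 0F = x₀ , level-∉ x₀∉T
      level-onto 1F = y₀ , level-∈ y₀∈T

      QuotLe⇒≤ : ∀ {x y} → QuotLe P Q r x y → level x Fin.≤ level y
      QuotLe⇒≤ (u , v , x~u , y~v , u⊑v) =
        subst₂ Fin._≤_ (sym (Sym⇒sameLevel x~u)) (sym (Sym⇒sameLevel y~v)) (level-monotone u⊑v)

      sameLevel⇒QuotLe : ∀ {x y} → level x ≡ level y → QuotLe P Q r x y
      sameLevel⇒QuotLe {y = y} lx≡ly = y , y , sameLevel⇒Sym lx≡ly , EqClosure.reflexive _ , ⊑-refl

      ≤⇒QuotLe : ∀ x y → level x Fin.≤ level y → QuotLe P Q r x y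
      ≤⇒QuotLe x y lx≤ly with x ∈? T | y ∈? T
      ... | yes x∈T | yes y∈T = sameLevel⇒QuotLe (trans (level-∈ x∈T) (sym (level-∈ y∈T)))
      ... | no  x∉T | no  y∉T = sameLevel⇒QuotLe (trans (level-∉ x∉T) (sym (level-∉ y∉T)))
      ≤⇒QuotLe x y () | yes _ | no _   -- level x ≤ level y has reduced to 1 ≤ 0
      ... | no  x∉T | yes y∈T =
        let z , z∈T , x⊑z = below-T x∉T
        in x , z , EqClosure.reflexive _ , sameLevel⇒Sym (trans (level-∈ y∈T) (sym (level-∈ z∈T))) , x⊑z

module CrownStructure (n : ℕ) where

  open FinPoset (Crown n) using () renaming (_≤_ to _⊑_)
  open Poset (Crown n)

  a b : Fin n → Fin (n + n)
  a k = k ↑ˡ n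
  b k = n ↑ʳ k

  data View : Fin (n + n) → Set where
    isA : ∀ k → View (a k)
    isB : ∀ k → View (b k)

  view : ∀ x → View x
  view x = subst View (join-splitAt n n x) (view-join (splitAt n x))
    where
    view-join : ∀ u → View (join n n u)
    view-join (inj₁ k) = isA k
    view-join (inj₂ k) = isB k

  a-injective : ∀ {k l} → a k ≡ a l → k ≡ l
  a-injective = ↑ˡ-injective n _ _

  b-injective : ∀ {k l} → b k ≡ b l → k ≡ l
  b-injective = ↑ʳ-injective n _ _

  a⊑b : ∀ {k l} → k ≢ l → a k ⊑ b l
  a⊑b {k} {l} k≢l = subst₂ CLe (sym (splitAt-↑ˡ n k n)) (sym (splitAt-↑ʳ n n l)) (cab k≢l)

  isTop : Fin n ⊎ Fin n → Bool
  isTop = Sum.[ const false , const true ]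

  Tops : Subset (n + n)
  Tops = tabulate (isTop ∘ splitAt n)

  a∉Tops : ∀ {k} → a k ∉ Tops
  a∉Tops {k} = ∉-tabulate (cong isTop (splitAt-↑ˡ n k n))

  b∈Tops : ∀ {k} → b k ∈ Tops
  b∈Tops {k} = ∈-tabulate⁺ (cong isTop (splitAt-↑ʳ n n k))

  a⊏b : ∀ {k l} → k ≢ l → a k ⊏ b l
  a⊏b k≢l = a⊑b k≢l , λ a≡b → a∉Tops (subst (_∈ Tops) (sym a≡b) b∈Tops)

  ⊏⇒∉∈ : ∀ {x y} → x ⊏ y → x ∉ Tops × y ∈ Tops
  ⊏⇒∉∈ {x} {y} (x⊑y , x≢y) =
    let top-x , top-y = strict x⊑y (x≢y ∘ splitAt-injective) in ∉-tabulate top-x , ∈-tabulate⁺ top-y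
    where
    splitAt-injective : splitAt n x ≡ splitAt n y → x ≡ y
    splitAt-injective e = trans (sym (join-splitAt n n x)) (trans (cong (join n n) e) (join-splitAt n n y))
    strict : ∀ {u v} → CLe u v → u ≢ v → isTop u ≡ false × isTop v ≡ true
    strict (crefl _) u≢u = ⊥-elim (u≢u refl)
    strict (cab _)   _   = refl , refl

  open TwoLevel (Crown n) Tops ⊏⇒∉∈ public

  below-Tops : 2 ≤ n → ∀ {x} → x ∉ Tops → ∃ λ z → z ∈ Tops × x ⊑ z
  below-Tops 2≤n {x} x∉T with view x
  ... | isA k = let l , l≢k = another 2≤n k in b l , b∈Tops , a⊑b (l≢k ∘ sym)
  ... | isB k = ⊥-elim (x∉T b∈Tops)

  relabelWith : (Fin n → Fin n) → Fin (n + n) → Fin (n + n)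
  relabelWith f = join n n ∘ Sum.map f f ∘ splitAt n

  relabelWith-inverse : ∀ {f g} → (∀ k → g (f k) ≡ k) → ∀ x → relabelWith g (relabelWith f x) ≡ x
  relabelWith-inverse {f} {g} g∘f≗id x = begin
    join n n (Sum.map g g (splitAt n (join n n (Sum.map f f (splitAt n x)))))
      ≡⟨ cong (join n n ∘ Sum.map g g) (splitAt-join n n (Sum.map f f (splitAt n x))) ⟩
    join n n (Sum.map g g (Sum.map f f (splitAt n x)))
      ≡⟨ cong (join n n) (trans (map-map u) (trans (map-cong g∘f≗id g∘f≗id u) (map-id u))) ⟩
    join n n (splitAt n x)
      ≡⟨ join-splitAt n n x ⟩
    x ∎
    where
    open ≡-Reasoning
    u = splitAt n x

  relabelWith-monotone : ∀ {f} → (∀ {k l} → f k ≡ f l → k ≡ l) →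
                         ∀ {x y} → x ⊑ y → relabelWith f x ⊑ relabelWith f y
  relabelWith-monotone {f} f-injective x⊑y =
    subst₂ CLe (sym (splitAt-join n n _)) (sym (splitAt-join n n _)) (map-CLe x⊑y)
    where
    map-CLe : ∀ {u v} → CLe u v → CLe (Sum.map f f u) (Sum.map f f v)
    map-CLe (crefl _) = crefl _
    map-CLe (cab k≢l) = cab (k≢l ∘ f-injective)

  relabel : Permutation′ n → Automorphism (Crown n)
  relabel π = mkAutomorphism (relabelWith (π ⟨$⟩ʳ_)) (relabelWith (π ⟨$⟩ˡ_))
    (relabelWith-inverse (λ _ → inverseˡ π)) (relabelWith-inverse (λ _ → inverseʳ π))
    (relabelWith-monotone λ e → trans (sym (inverseˡ π)) (trans (cong (π ⟨$⟩ˡ_) e) (inverseˡ π)))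
    (relabelWith-monotone λ e → trans (sym (inverseʳ π)) (trans (cong (π ⟨$⟩ʳ_) e) (inverseʳ π)))

  relabel-a : ∀ π k → fun (relabel π) (a k) ≡ a (π ⟨$⟩ʳ k)
  relabel-a π k = cong (join n n ∘ Sum.map _ _) (splitAt-↑ˡ n k n)

  relabel-b : ∀ π k → fun (relabel π) (b k) ≡ b (π ⟨$⟩ʳ k)
  relabel-b π k = cong (join n n ∘ Sum.map _ _) (splitAt-↑ʳ n n k)

  swap : Fin n → Fin n → Automorphism (Crown n)
  swap c d = relabel (transpose c d)

  module _ {c d : Fin n} (c≢d : c ≢ d) where

    private
      τ = transpose c d
      lower upper : Fin 2 → Fin (n + n)
      lower 0F = a c
      lower 1F = a d
      upper 0F = b d
      upper 1F = b c

    swap-isGenerator : IsGenerator (Crown n) C₂ 2 (swap c d) (λ i → pair (lower i) (upper i))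
    swap-isGenerator = cyclic-pairs-isGenerator (swap c d) lower upper lower⊏upper
      (λ i → pair⊆ (moved (σ-lower i) (lower-moves i)) (moved (σ-upper i) (upper-moves i)))
      σ-lower σ-upper covers
      where
      d≢c = c≢d ∘ sym
      lower⊏upper : ∀ i → lower i ⊏ upper i
      lower⊏upper 0F = a⊏b c≢d
      lower⊏upper 1F = a⊏b d≢c
      σ-lower : ∀ i → fun (swap c d) (lower i) ≡ lower (next 2 i)
      σ-lower 0F = trans (relabel-a τ c) (cong a (transpose-ˡ c d))
      σ-lower 1F = trans (relabel-a τ d) (cong a (transpose-ʳ c d))
      σ-upper : ∀ i → fun (swap c d) (upper i) ≡ upper (next 2 i)
      σ-upper 0F = trans (relabel-b τ d) (cong b (transpose-ʳ c d))
      σ-upper 1F = trans (relabel-b τ c) (cong b (transpose-ˡ c d))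
      lower-moves : ∀ i → lower (next 2 i) ≢ lower i
      lower-moves 0F = d≢c ∘ a-injective
      lower-moves 1F = c≢d ∘ a-injective
      upper-moves : ∀ i → upper (next 2 i) ≢ upper i
      upper-moves 0F = c≢d ∘ b-injective
      upper-moves 1F = d≢c ∘ b-injective
      moved : ∀ {p q} → fun (swap c d) p ≡ q → q ≢ p → p ∈ support (Crown n) (swap c d)
      moved σp≡q q≢p = ∈support⁺ (swap c d) (q≢p ∘ trans (sym σp≡q))
      covers : ∀ p → p ∈ support (Crown n) (swap c d) → ∃ λ i → p ∈ pair (lower i) (upper i)
      covers p p∈Σ with view p
      ... | isA k with transpose-moved c d (∈support⁻ (swap c d) p∈Σ ∘ trans (relabel-a τ k) ∘ cong a)
      ...   | inj₁ refl = 0F , x∈pair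
      ...   | inj₂ refl = 1F , x∈pair
      covers p p∈Σ | isB k with transpose-moved c d (∈support⁻ (swap c d) p∈Σ ∘ trans (relabel-b τ k) ∘ cong b)
      ...   | inj₁ refl = 1F , y∈pair
      ...   | inj₂ refl = 0F , y∈pair

    swap-a-Sym1 : Sym1 (Crown n) C₂ 2 (a c) (a d)
    swap-a-Sym1 = swap c d , _ , swap-isGenerator , (0F , x∈pair)
                , 1 , s≤s z≤n , s≤s (s≤s z≤n) , sym (trans (relabel-a τ c) (cong a (transpose-ˡ c d)))

    swap-b-Sym1 : Sym1 (Crown n) C₂ 2 (b d) (b c)
    swap-b-Sym1 = swap c d , _ , swap-isGenerator , (0F , y∈pair)
                , 1 , s≤s z≤n , s≤s (s≤s z≤n) , sym (trans (relabel-b τ d) (cong b (transpose-ʳ c d)))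

  a-Sym : ∀ k l → Sym (Crown n) C₂ 2 (a k) (a l)
  a-Sym k l with k ≟ l
  ... | yes refl = EqClosure.reflexive _
  ... | no  k≢l  = EqClosure.return (swap-a-Sym1 k≢l)

  b-Sym : ∀ k l → Sym (Crown n) C₂ 2 (b k) (b l)
  b-Sym k l with l ≟ k
  ... | yes refl = EqClosure.reflexive _
  ... | no  l≢k  = EqClosure.return (swap-b-Sym1 l≢k)

  sameLevel⇒Sym : ∀ {x y} → level x ≡ level y → Sym (Crown n) C₂ 2 x y
  sameLevel⇒Sym {x} {y} lx≡ly with view x | view y
  ... | isA k | isA l = a-Sym k l
  ... | isB k | isB l = b-Sym k l
  ... | isA k | isB l =
    contradiction (trans (sym (level-∉ (a∉Tops {k}))) (trans lx≡ly (level-∈ b∈Tops))) λ ()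
  ... | isB k | isA l =
    contradiction (trans (sym (level-∉ (a∉Tops {l}))) (trans (sym lx≡ly) (level-∈ b∈Tops))) λ ()

mainTheorem6 : ∀ (n : ℕ) → 2 ≤ n → Retractable (Crown n) C₂ 2 C₂
mainTheorem6 n@(suc (suc _)) 2≤n =
    quotient≅C₂ {C₂} {2} sameLevel⇒Sym (a 0F , a∉Tops) (b 0F , b∈Tops)
  , a 0F , a 1F , (λ ()) ∘ a-injective , a-Sym 0F 1F
  where
  open CrownStructure n
  open Covered (below-Tops 2≤n)
mainTheorem6 1 (s≤s ())
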